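{- Let $a,b,c,k\ge1$. Let $\psi$ be the reflection of the plane across a vertical line, and for a $k$-tiling $(T_1,\dots,T_k)$ of $H(a,b,c)$ set $\Phi(T_1,\dots,T_k)=(\psi T_k,\dots,\psi T_1)$ (flip each tiling and reverse the order of the colors; after a translation these are tilings of $H(c,b,a)$). Then $\Phi$ is a bijection between $k$-tilings of $H(a,b,c)$ and $k$-tilings of $H(c,b,a)$, and a $k$-tiling with $j$ interactions is mapped to one with $\binom{k}{2}(bc-ab)+j$ interactions.
   Context: Work in the triangular lattice of unit equilateral triangles with one family of edges horizontal. For positive integers $a,b,c$, $H(a,b,c)$ is the lattice hexagon whose sides, listed counterclockwise starting from the bottom, have lengths $b,c,a,b,c,a$ and directions $0^\circ,60^\circ,120^\circ,180^\circ,240^\circ,300^\circ$. A lozenge is the union of a downward-pointing unit triangle $\Delta$ and an upward-pointing unit triangle sharing an edge with it; a lozenge tiling $T$ of $H(a,b,c)$ thus matches each down-pointing triangle $\Delta$ of $H(a,b,c)$ across exactly one of its three edges: its top (horizontal) edge, its left edge, or its right edge (the edge joining its bottom vertex to its upper-right vertex). A $k$-tiling is a $k$-tuple $(T_1,\dots,T_k)$ of lozenge tilings; $T_c$ has color $c$. For colors $1\le\alpha<\beta\le k$ and a down-pointing triangle $\Delta$, the triple $(\alpha,\beta,\Delta)$ is an interaction if $T_\alpha$ matches $\Delta$ across its right edge and $T_\beta$ matches $\Delta$ across its right edge or across its top edge. -}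

module Defs where

open import Data.Nat using (ℕ; zero; suc; _+_; _*_; _∸_; _≤_; _<?_; _≤?_)
open import Data.Nat.Combinatorics using (_C_)
open import Data.Bool using (Bool; true; false; _∧_; _∨_; if_then_else_)
open import Data.Fin using (Fin; toℕ; opposite)
open import Data.List using (List; map; upTo; allFin)
open import Data.Nat.ListAction using (sum)
open import Data.Product using (Σ; _×_; _,_)
open import Relation.Binary.PropositionalEquality using (_≡_)
open import Relation.Nullary.Decidable using (⌊_⌋)

-- A lattice point is x·e₁ + y·e₂ with e₁ = (1,0) (0°) and
-- e₂ = (1/2, √3/2) (60°).  The hexagon H(a,b,c) has vertices
-- (a,0),(a+b,0),(a+b,c),(b,a+c),(0,a+c),(0,a), i.e. it is the region
-- x ≥ 0, y ≥ 0, x+y ≥ a, x ≤ a+b, y ≤ a+c, x+y ≤ a+b+c.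
--
-- Down triangle Δ(x,y): vertices (x+1,y) (bottom), (x,y+1), (x+1,y+1).
--   top edge   (x,y+1)-(x+1,y+1)  : neighbour up triangle U(x,y+1)
--   left edge  (x+1,y)-(x,y+1)    : neighbour up triangle U(x,y)
--   right edge (x+1,y)-(x+1,y+1)  : neighbour up triangle U(x+1,y)
-- Up triangle U(x,y): vertices (x,y), (x+1,y), (x,y+1).

data Dir : Set where
  top left right : Dir

DownIn : ℕ → ℕ → ℕ → ℕ → ℕ → Set
DownIn a b c x y =
  (suc x ≤ a + b) × (suc y ≤ a + c) × (a ≤ suc (x + y)) × (suc (suc (x + y)) ≤ a + b + c)

downIn? : ℕ → ℕ → ℕ → ℕ → ℕ → Bool
downIn? a b c x y =
  ⌊ suc x ≤? a + b ⌋ ∧ ⌊ suc y ≤? a + c ⌋ ∧ ⌊ a ≤? suc (x + y) ⌋ ∧ ⌊ suc (suc (x + y)) ≤? a + b + c ⌋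

UpIn : ℕ → ℕ → ℕ → ℕ → ℕ → Set
UpIn a b c x y =
  (a ≤ x + y) × (suc x ≤ a + b) × (suc y ≤ a + c) × (suc (x + y) ≤ a + b + c)

partner : Dir → ℕ → ℕ → ℕ × ℕ
partner top   x y = x , suc y
partner left  x y = x , y
partner right x y = suc x , y

-- A (raw) tiling assigns to each down triangle Δ(x,y) the edge across
-- which it is matched; only values on down triangles of H matter.
Grid : Set
Grid = ℕ → ℕ → Dir

-- Lozenge tiling of H(a,b,c) = perfect matching between down and up
-- triangles of H(a,b,c) along shared edges.
IsTiling : ℕ → ℕ → ℕ → Grid → Set
IsTiling a b c T =
  (∀ x y → DownIn a b c x y →
     Σ ℕ λ u → Σ ℕ λ v → partner (T x y) x y ≡ (u , v) × UpIn a b c u v)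
  × (∀ x y x′ y′ → DownIn a b c x y → DownIn a b c x′ y′ →
       partner (T x y) x y ≡ partner (T x′ y′) x′ y′ → (x , y) ≡ (x′ , y′))
  × (∀ u v → UpIn a b c u v →
       Σ ℕ λ x → Σ ℕ λ y → DownIn a b c x y × partner (T x y) x y ≡ (u , v))

-- k-tilings: color i ∈ Fin k (colour i+1 in the paper)
KGrid : ℕ → Set
KGrid k = Fin k → Grid

IsKTiling : ℕ → ℕ → ℕ → (k : ℕ) → KGrid k → Set
IsKTiling a b c k T = ∀ i → IsTiling a b c (T i)

SameKT : ℕ → ℕ → ℕ → (k : ℕ) → KGrid k → KGrid k → Set
SameKT a b c k T S = ∀ i x y → DownIn a b c x y → T i x y ≡ S i x y

-- Reflection ψ across a vertical line, followed by the translation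
-- taking ψ(H(a,b,c)) onto H(c,b,a): on lattice points it is
-- (x,y) ↦ (a+b+c−x−y, y).  It maps Δ(x,y) to Δ(a+b+c−x−y−2, y),
-- exchanging left and right edges and fixing top edges.

swapLR : Dir → Dir
swapLR top   = top
swapLR left  = right
swapLR right = left

ψ : ℕ → ℕ → ℕ → Grid → Grid
ψ a b c T x y = swapLR (T (a + b + c ∸ (x + y + 2)) y)

Φ : ℕ → ℕ → ℕ → (k : ℕ) → KGrid k → KGrid k
Φ a b c k T i = ψ a b c (T (opposite i))

isRight : Dir → Bool
isRight right = true
isRight _     = false

isRightOrTop : Dir → Bool
isRightOrTop right = true
isRightOrTop top   = true
isRightOrTop left  = false

interaction? : ℕ → ℕ → ℕ → (k : ℕ) → KGrid k → Fin k → Fin k → ℕ → ℕ → Bool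
interaction? a b c k T α β x y =
  ⌊ toℕ α <? toℕ β ⌋ ∧ downIn? a b c x y ∧ isRight (T α x y) ∧ isRightOrTop (T β x y)

toNat : Bool → ℕ
toNat true  = 1
toNat false = 0

-- number of interactions; every down triangle of H(a,b,c) has
-- x < a+b and y < a+c, so these ranges cover all of them.
interactions : ℕ → ℕ → ℕ → (k : ℕ) → KGrid k → ℕ
interactions a b c k T =
  sum (map (λ α → sum (map (λ β → sum (map (λ x → sum (map (λ y →
    toNat (interaction? a b c k T α β x y)) (upTo (a + c)))) (upTo (a + b))))
    (allFin k))) (allFin k))

{-# OPTIONS --safe #-}
module Submission where

-- A lozenge tiling of H(a,b,c) is a perfect matching between its down- and up-pointing
-- triangles. The reflection ψ maps the triangles of H(a,b,c) bijectively onto those of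
-- H(c,b,a), exchanging left and right edges, so it maps tilings to tilings; and since ψ is
-- an involution, the map Φ for H(c,b,a) inverts the one for H(a,b,c).
--
-- Summing, over the down triangles, the x-coordinate of the up triangle they are matched
-- with shows that every tiling of H(a,b,c) matches exactly ab down triangles across their
-- right edge, and by reflection exactly cb across their left edge. For two tilings T₁, T₂
-- and every down triangle,
--   [T₁ left or top]·[T₂ left] + [T₁ right] = [T₁ right]·[T₂ right or top] + [T₂ left],
-- so over H the (left-or-top, left) coincidences of (T₁, T₂) outnumber the
-- (right, right-or-top) ones by bc − ab. Since Φ turns the interactions of colours α < β
-- into (left-or-top, left) coincidences of the colours k+1−β < k+1−α, each of the k C 2
-- pairs of colours gains bc − ab interactions.

import Algebra.Properties.CommutativeSemigroup
open import Data.Bool using (Bool; true; false; _∧_)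
open import Data.Fin using (Fin; zero; suc; toℕ; opposite; inject₁; fromℕ)
open import Data.Fin.Properties using (opposite-prop; opposite-involutive; toℕ<n)
open import Data.List using (List; []; _∷_; _++_; [_]; length; map; upTo; allFin)
open import Data.List.Properties
  using (map-cong; map-++; map-upTo; map-applyUpTo; map-tabulate; upTo-∷ʳ; length-upTo; length-tabulate)
open import Data.Nat using (ℕ; zero; suc; _+_; _*_; _∸_; _≤_; _<_; _≤?_; _<?_; _≡ᵇ_; s≤s; s≤s⁻¹; z≤n)
open import Data.Nat.Combinatorics using (_C_; nC1≡n; nCk+nC[k+1]≡[n+1]C[k+1])
open import Data.Nat.ListAction using (sum)
open import Data.Nat.ListAction.Properties using (sum-++)
open import Data.Nat.Properties
open import Data.Nat.Tactic.RingSolver using (solve-∀)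
open import Data.Product using (Σ; _×_; _,_; proj₁; proj₂; uncurry)
open import Data.Product.Properties using (≡-dec)
open import Function using (_∘_; _⇔_; mk⇔; Equivalence)
open import Relation.Binary.PropositionalEquality
  using (_≡_; _≢_; refl; sym; trans; cong; cong₂; subst; subst₂; module ≡-Reasoning)
open import Relation.Nullary using (Dec; yes; no; ¬_; contradiction)
open import Relation.Nullary.Decidable using (⌊_⌋)
open import Relation.Nullary.Reflects using (Reflects; ofʸ; ofⁿ; _×-reflects_)

open import Defs

open Algebra.Properties.CommutativeSemigroup +-commutativeSemigroup using (interchange)

private
  variable
    A B P Q : Set
    k : ℕ

toNat-∧ : ∀ p q → toNat (p ∧ q) ≡ toNat p * toNat q
toNat-∧ true  q = sym (+-identityʳ (toNat q))
toNat-∧ false q = refl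

toNat-reflects-yes : ∀ {b} → Reflects P b → P → toNat b ≡ 1
toNat-reflects-yes (ofʸ _)  _ = refl
toNat-reflects-yes (ofⁿ ¬p) p = contradiction p ¬p

toNat-reflects-no : ∀ {b} → Reflects P b → ¬ P → toNat b ≡ 0
toNat-reflects-no (ofʸ p) ¬p = contradiction p ¬p
toNat-reflects-no (ofⁿ _) _  = refl

⌊⌋-reflects : (p? : Dec P) → Reflects P ⌊ p? ⌋
⌊⌋-reflects (yes p) = ofʸ p
⌊⌋-reflects (no ¬p) = ofⁿ ¬p

reflects-⇔ : ∀ {b b′} → Reflects P b → Reflects Q b′ → P ⇔ Q → b ≡ b′
reflects-⇔ (ofʸ p)  (ofʸ q)  P⇔Q = refl
reflects-⇔ (ofʸ p)  (ofⁿ ¬q) P⇔Q = contradiction (Equivalence.to P⇔Q p) ¬q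
reflects-⇔ (ofⁿ ¬p) (ofʸ q)  P⇔Q = contradiction (Equivalence.from P⇔Q q) ¬p
reflects-⇔ (ofⁿ ¬p) (ofⁿ ¬q) P⇔Q = refl

∑ : List A → (A → ℕ) → ℕ
∑ xs f = sum (map f xs)

infix 10 ∑
syntax ∑ xs (λ x → e) = ∑[ x ∈ xs ] e

∑-cong : ∀ (xs : List A) {f g : A → ℕ} → (∀ x → f x ≡ g x) → ∑ xs f ≡ ∑ xs g
∑-cong xs f≗g = cong sum (map-cong f≗g xs)

∑-+ : ∀ (xs : List A) (f g : A → ℕ) → ∑[ x ∈ xs ] (f x + g x) ≡ ∑ xs f + ∑ xs g
∑-+ []       f g = refl
∑-+ (x ∷ xs) f g = trans (cong (f x + g x +_) (∑-+ xs f g)) (interchange (f x) (g x) _ _)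

∑-*ˡ : ∀ (xs : List A) n (f : A → ℕ) → ∑[ x ∈ xs ] (n * f x) ≡ n * ∑ xs f
∑-*ˡ []       n f = sym (*-zeroʳ n)
∑-*ˡ (x ∷ xs) n f = trans (cong (n * f x +_) (∑-*ˡ xs n f)) (sym (*-distribˡ-+ n (f x) _))

∑-*ʳ : ∀ (xs : List A) n (f : A → ℕ) → ∑[ x ∈ xs ] (f x * n) ≡ ∑ xs f * n
∑-*ʳ xs n f = trans (∑-cong xs (λ x → *-comm (f x) n)) (trans (∑-*ˡ xs n f) (*-comm n _))

∑-zero : ∀ (xs : List A) → ∑[ x ∈ xs ] 0 ≡ 0
∑-zero xs = ∑-*ˡ xs 0 (λ _ → 0)

∑-const : ∀ (xs : List A) n → ∑[ x ∈ xs ] n ≡ length xs * n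
∑-const []       n = refl
∑-const (x ∷ xs) n = cong (n +_) (∑-const xs n)

∑-comm : ∀ (xs : List A) (ys : List B) (f : A → B → ℕ) →
         ∑[ x ∈ xs ] ∑[ y ∈ ys ] f x y ≡ ∑[ y ∈ ys ] ∑[ x ∈ xs ] f x y
∑-comm []       ys f = sym (∑-zero ys)
∑-comm (x ∷ xs) ys f =
  trans (cong (∑ ys (f x) +_) (∑-comm xs ys f)) (sym (∑-+ ys (f x) (λ y → ∑[ x ∈ xs ] f x y)))

∑-upTo-suc : ∀ n (f : ℕ → ℕ) → ∑ (upTo (suc n)) f ≡ f 0 + ∑[ i ∈ upTo n ] f (suc i)
∑-upTo-suc n f =
  cong (λ xs → f 0 + sum xs) (trans (map-applyUpTo suc f n) (sym (map-upTo (f ∘ suc) n)))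

∑-upTo-∷ʳ : ∀ n (f : ℕ → ℕ) → ∑ (upTo (suc n)) f ≡ ∑ (upTo n) f + f n
∑-upTo-∷ʳ n f = begin
  sum (map f (upTo (suc n)))      ≡⟨ cong (sum ∘ map f) (upTo-∷ʳ n) ⟨
  sum (map f (upTo n ++ [ n ]))   ≡⟨ cong sum (map-++ f (upTo n) [ n ]) ⟩
  sum (map f (upTo n) ++ [ f n ]) ≡⟨ sum-++ (map f (upTo n)) [ f n ] ⟩
  ∑ (upTo n) f + (f n + 0)        ≡⟨ cong (∑ (upTo n) f +_) (+-identityʳ (f n)) ⟩
  ∑ (upTo n) f + f n              ∎
  where open ≡-Reasoning

∑-upTo-+ : ∀ m n (f : ℕ → ℕ) → ∑ (upTo (m + n)) f ≡ ∑ (upTo m) f + ∑[ i ∈ upTo n ] f (m + i)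
∑-upTo-+ zero    n f = refl
∑-upTo-+ (suc m) n f = begin
  ∑ (upTo (suc (m + n))) f
    ≡⟨ ∑-upTo-suc (m + n) f ⟩
  f 0 + ∑[ i ∈ upTo (m + n) ] f (suc i)
    ≡⟨ cong (f 0 +_) (∑-upTo-+ m n (f ∘ suc)) ⟩
  f 0 + (∑[ i ∈ upTo m ] f (suc i) + ∑[ i ∈ upTo n ] f (suc m + i))
    ≡⟨ +-assoc (f 0) _ _ ⟨
  f 0 + ∑[ i ∈ upTo m ] f (suc i) + ∑[ i ∈ upTo n ] f (suc m + i)
    ≡⟨ cong (_+ ∑[ i ∈ upTo n ] f (suc m + i)) (∑-upTo-suc m f) ⟨
  ∑ (upTo (suc m)) f + ∑[ i ∈ upTo n ] f (suc m + i) ∎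
  where open ≡-Reasoning

∑-upTo-cong : ∀ n {f g : ℕ → ℕ} → (∀ i → i < n → f i ≡ g i) → ∑ (upTo n) f ≡ ∑ (upTo n) g
∑-upTo-cong zero    f≗g = refl
∑-upTo-cong (suc n) {f} {g} f≗g = begin
  ∑ (upTo (suc n)) f               ≡⟨ ∑-upTo-suc n f ⟩
  f 0 + ∑[ i ∈ upTo n ] f (suc i)  ≡⟨ cong₂ _+_ (f≗g 0 (s≤s z≤n))
                                              (∑-upTo-cong n (λ i → f≗g (suc i) ∘ s≤s)) ⟩
  g 0 + ∑[ i ∈ upTo n ] g (suc i)  ≡⟨ ∑-upTo-suc n g ⟨
  ∑ (upTo (suc n)) g               ∎
  where open ≡-Reasoning

∑-upTo-zero : ∀ n (f : ℕ → ℕ) → (∀ i → i < n → f i ≡ 0) → ∑ (upTo n) f ≡ 0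
∑-upTo-zero n f f≗0 = trans (∑-upTo-cong n f≗0) (∑-zero (upTo n))

∑-upTo-δ : ∀ n {i} (f : ℕ → ℕ) → i < n → ∑[ j ∈ upTo n ] (toNat (i ≡ᵇ j) * f j) ≡ f i
∑-upTo-δ (suc n) {zero} f _ = begin
  ∑[ j ∈ upTo (suc n) ] (toNat (0 ≡ᵇ j) * f j) ≡⟨ ∑-upTo-suc n _ ⟩
  f 0 + 0 + ∑[ j ∈ upTo n ] 0                 ≡⟨ cong (f 0 + 0 +_) (∑-zero (upTo n)) ⟩
  f 0 + 0 + 0                                 ≡⟨ trans (+-identityʳ _) (+-identityʳ _) ⟩
  f 0                                         ∎
  where open ≡-Reasoning
∑-upTo-δ (suc n) {suc i} f (s≤s i<n) =
  trans (∑-upTo-suc n (λ j → toNat (suc i ≡ᵇ j) * f j)) (∑-upTo-δ n (f ∘ suc) i<n)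

∑-allFin-suc : ∀ k (f : Fin (suc k) → ℕ) → ∑ (allFin (suc k)) f ≡ f zero + ∑[ i ∈ allFin k ] f (suc i)
∑-allFin-suc k f =
  cong (λ xs → f zero + sum xs) (trans (map-tabulate suc f) (sym (map-tabulate (λ i → i) (f ∘ suc))))

∑-allFin-∷ʳ : ∀ k (f : Fin (suc k) → ℕ) →
              ∑ (allFin (suc k)) f ≡ ∑[ i ∈ allFin k ] f (inject₁ i) + f (fromℕ k)
∑-allFin-∷ʳ zero    f = +-comm (f zero) 0
∑-allFin-∷ʳ (suc k) f = begin
  ∑ (allFin (suc (suc k))) f
    ≡⟨ ∑-allFin-suc (suc k) f ⟩
  f zero + ∑[ i ∈ allFin (suc k) ] f (suc i)
    ≡⟨ cong (f zero +_) (∑-allFin-∷ʳ k (f ∘ suc)) ⟩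
  f zero + (∑[ i ∈ allFin k ] f (suc (inject₁ i)) + f (fromℕ (suc k)))
    ≡⟨ +-assoc (f zero) _ _ ⟨
  f zero + ∑[ i ∈ allFin k ] f (suc (inject₁ i)) + f (fromℕ (suc k))
    ≡⟨ cong (_+ f (fromℕ (suc k))) (∑-allFin-suc k (f ∘ inject₁)) ⟨
  ∑[ i ∈ allFin (suc k) ] f (inject₁ i) + f (fromℕ (suc k)) ∎
  where open ≡-Reasoning

∑-allFin-opposite : ∀ k (f : Fin k → ℕ) → ∑[ i ∈ allFin k ] f (opposite i) ≡ ∑ (allFin k) f
∑-allFin-opposite zero    f = refl
∑-allFin-opposite (suc k) f = begin
  ∑[ i ∈ allFin (suc k) ] f (opposite i)
    ≡⟨ ∑-allFin-suc k (f ∘ opposite) ⟩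
  f (fromℕ k) + ∑[ i ∈ allFin k ] f (inject₁ (opposite i))
    ≡⟨ cong (f (fromℕ k) +_) (∑-allFin-opposite k (f ∘ inject₁)) ⟩
  f (fromℕ k) + ∑[ i ∈ allFin k ] f (inject₁ i)
    ≡⟨ +-comm (f (fromℕ k)) _ ⟩
  ∑[ i ∈ allFin k ] f (inject₁ i) + f (fromℕ k)
    ≡⟨ ∑-allFin-∷ʳ k f ⟨
  ∑ (allFin (suc k)) f ∎
  where open ≡-Reasoning

<-opposite : ∀ (α β : Fin k) → toℕ α < toℕ β ⇔ toℕ (opposite β) < toℕ (opposite α)
<-opposite {k} α β = mk⇔ to from
  where
  to : toℕ α < toℕ β → toℕ (opposite β) < toℕ (opposite α)
  to α<β = subst₂ _<_ (sym (opposite-prop β)) (sym (opposite-prop α)) (∸-monoʳ-< (s≤s α<β) (toℕ<n β))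
  from : toℕ (opposite β) < toℕ (opposite α) → toℕ α < toℕ β
  from opβ<opα = ≰⇒> λ β≤α → <⇒≱ opβ<opα
    (subst₂ _≤_ (sym (opposite-prop α)) (sym (opposite-prop β)) (∸-monoʳ-≤ k (s≤s β≤α)))

ordered : Fin k → Fin k → ℕ
ordered α β = toNat ⌊ toℕ α <? toℕ β ⌋

ordered-suc : ∀ (α β : Fin k) → ordered (suc α) (suc β) ≡ ordered α β
ordered-suc α β = cong toNat (reflects-⇔ (⌊⌋-reflects _) (⌊⌋-reflects _) (mk⇔ s≤s⁻¹ s≤s))

ordered-opposite : ∀ (α β : Fin k) → ordered α β ≡ ordered (opposite β) (opposite α)
ordered-opposite α β = cong toNat (reflects-⇔ (⌊⌋-reflects _) (⌊⌋-reflects _) (<-opposite α β))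

∑pairs : (k : ℕ) → (Fin k → Fin k → ℕ) → ℕ
∑pairs k F = ∑[ α ∈ allFin k ] ∑[ β ∈ allFin k ] (ordered α β * F α β)

∑pairs-cong : ∀ k {F G : Fin k → Fin k → ℕ} →
              (∀ α β → F α β ≡ G α β) → ∑pairs k F ≡ ∑pairs k G
∑pairs-cong k F≗G =
  ∑-cong (allFin k) (λ α → ∑-cong (allFin k) (λ β → cong (ordered α β *_) (F≗G α β)))

∑pairs-+ : ∀ k (F G : Fin k → Fin k → ℕ) →
           ∑pairs k (λ α β → F α β + G α β) ≡ ∑pairs k F + ∑pairs k G
∑pairs-+ k F G = begin
  ∑pairs k (λ α β → F α β + G α β)
    ≡⟨ ∑-cong (allFin k) (λ α → trans
         (∑-cong (allFin k) (λ β → *-distribˡ-+ (ordered α β) (F α β) (G α β)))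
         (∑-+ (allFin k) (λ β → ordered α β * F α β) (λ β → ordered α β * G α β))) ⟩
  ∑[ α ∈ allFin k ] (∑[ β ∈ allFin k ] (ordered α β * F α β)
                      + ∑[ β ∈ allFin k ] (ordered α β * G α β))
    ≡⟨ ∑-+ (allFin k) _ _ ⟩
  ∑pairs k F + ∑pairs k G ∎
  where open ≡-Reasoning

∑pairs-const : ∀ k n → ∑pairs k (λ _ _ → n) ≡ (k C 2) * n
∑pairs-const zero    n = refl
∑pairs-const (suc k) n = begin
  ∑pairs (suc k) (λ _ _ → n)
    ≡⟨ ∑-allFin-suc k _ ⟩
  ∑[ β ∈ allFin (suc k) ] (ordered zero β * n)
    + ∑[ α ∈ allFin k ] ∑[ β ∈ allFin (suc k) ] (ordered (suc α) β * n)
    ≡⟨ cong₂ _+_ (∑-allFin-suc k (λ β → ordered zero β * n))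
                 (∑-cong (allFin k) (λ α → ∑-allFin-suc k (λ β → ordered (suc α) β * n))) ⟩
  ∑[ β ∈ allFin k ] (n + 0) + ∑[ α ∈ allFin k ] ∑[ β ∈ allFin k ] (ordered (suc α) (suc β) * n)
    ≡⟨ cong₂ _+_ (∑-const (allFin k) (n + 0))
                 (∑-cong (allFin k) (λ α → ∑-cong (allFin k) (λ β → cong (_* n) (ordered-suc α β)))) ⟩
  length (allFin k) * (n + 0) + ∑pairs k (λ _ _ → n)
    ≡⟨ cong₂ _+_ (cong₂ _*_ (trans (length-tabulate (λ i → i)) (sym (nC1≡n k))) (+-identityʳ n))
                 (∑pairs-const k n) ⟩
  (k C 1) * n + (k C 2) * n
    ≡⟨ *-distribʳ-+ n (k C 1) (k C 2) ⟨
  (k C 1 + k C 2) * n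
    ≡⟨ cong (_* n) (nCk+nC[k+1]≡[n+1]C[k+1] k 1) ⟩
  (suc k C 2) * n ∎
  where open ≡-Reasoning

∑pairs-opposite : ∀ k (F : Fin k → Fin k → ℕ) →
                  ∑pairs k (λ α β → F (opposite β) (opposite α)) ≡ ∑pairs k F
∑pairs-opposite k F = begin
  ∑[ α ∈ allFin k ] ∑[ β ∈ allFin k ] (ordered α β * F (opposite β) (opposite α))
    ≡⟨ ∑-cong (allFin k) (λ α → ∑-cong (allFin k) (λ β →
         cong (_* F (opposite β) (opposite α)) (ordered-opposite α β))) ⟩
  ∑[ α ∈ allFin k ] ∑[ β ∈ allFin k ] G (opposite β) (opposite α)
    ≡⟨ ∑-comm (allFin k) (allFin k) _ ⟩
  ∑[ β ∈ allFin k ] ∑[ α ∈ allFin k ] G (opposite β) (opposite α)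
    ≡⟨ ∑-cong (allFin k) (λ β → ∑-allFin-opposite k (G (opposite β))) ⟩
  ∑[ β ∈ allFin k ] ∑[ δ ∈ allFin k ] G (opposite β) δ
    ≡⟨ ∑-allFin-opposite k (λ γ → ∑[ δ ∈ allFin k ] G γ δ) ⟩
  ∑pairs k F ∎
  where
  open ≡-Reasoning
  G : Fin k → Fin k → ℕ
  G γ δ = ordered γ δ * F γ δ

∑□ : ℕ → ℕ → (ℕ × ℕ → ℕ) → ℕ
∑□ m n f = ∑[ x ∈ upTo m ] ∑[ y ∈ upTo n ] f (x , y)

∑□-cong : ∀ m n {f g : ℕ × ℕ → ℕ} → (∀ q → f q ≡ g q) → ∑□ m n f ≡ ∑□ m n g
∑□-cong m n f≗g = ∑-cong (upTo m) (λ x → ∑-cong (upTo n) (λ y → f≗g (x , y)))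

∑□-+ : ∀ m n (f g : ℕ × ℕ → ℕ) → ∑□ m n (λ q → f q + g q) ≡ ∑□ m n f + ∑□ m n g
∑□-+ m n f g = trans (∑-cong (upTo m) (λ x → ∑-+ (upTo n) _ _)) (∑-+ (upTo m) _ _)

∑□-*ˡ : ∀ m n c (f : ℕ × ℕ → ℕ) → ∑□ m n (λ q → c * f q) ≡ c * ∑□ m n f
∑□-*ˡ m n c f = trans (∑-cong (upTo m) (λ x → ∑-*ˡ (upTo n) c _)) (∑-*ˡ (upTo m) c _)

∑□-*ʳ : ∀ m n c (f : ℕ × ℕ → ℕ) → ∑□ m n (λ q → f q * c) ≡ ∑□ m n f * c
∑□-*ʳ m n c f = trans (∑-cong (upTo m) (λ x → ∑-*ʳ (upTo n) c _)) (∑-*ʳ (upTo m) c _)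

∑□-comm : ∀ m n m′ n′ (F : ℕ × ℕ → ℕ × ℕ → ℕ) →
          ∑□ m n (λ q → ∑□ m′ n′ (F q)) ≡ ∑□ m′ n′ (λ q′ → ∑□ m n (λ q → F q q′))
∑□-comm m n m′ n′ F = begin
  ∑[ x ∈ upTo m ] ∑[ y ∈ upTo n ] ∑[ x′ ∈ upTo m′ ] ∑[ y′ ∈ upTo n′ ] F (x , y) (x′ , y′)
    ≡⟨ ∑-cong (upTo m) (λ x → ∑-comm (upTo n) (upTo m′) _) ⟩
  ∑[ x ∈ upTo m ] ∑[ x′ ∈ upTo m′ ] ∑[ y ∈ upTo n ] ∑[ y′ ∈ upTo n′ ] F (x , y) (x′ , y′)
    ≡⟨ ∑-comm (upTo m) (upTo m′) _ ⟩
  ∑[ x′ ∈ upTo m′ ] ∑[ x ∈ upTo m ] ∑[ y ∈ upTo n ] ∑[ y′ ∈ upTo n′ ] F (x , y) (x′ , y′)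
    ≡⟨ ∑-cong (upTo m′) (λ x′ → ∑-cong (upTo m) (λ x → ∑-comm (upTo n) (upTo n′) _)) ⟩
  ∑[ x′ ∈ upTo m′ ] ∑[ x ∈ upTo m ] ∑[ y′ ∈ upTo n′ ] ∑[ y ∈ upTo n ] F (x , y) (x′ , y′)
    ≡⟨ ∑-cong (upTo m′) (λ x′ → ∑-comm (upTo m) (upTo n′) _) ⟩
  ∑[ x′ ∈ upTo m′ ] ∑[ y′ ∈ upTo n′ ] ∑[ x ∈ upTo m ] ∑[ y ∈ upTo n ] F (x , y) (x′ , y′) ∎
  where open ≡-Reasoning

δ : ℕ × ℕ → ℕ × ℕ → ℕ
δ (x , y) (x′ , y′) = toNat (x ≡ᵇ x′) * toNat (y ≡ᵇ y′)

toNat-≡ᵇ-refl : ∀ n → toNat (n ≡ᵇ n) ≡ 1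
toNat-≡ᵇ-refl zero    = refl
toNat-≡ᵇ-refl (suc n) = toNat-≡ᵇ-refl n

toNat-≡ᵇ-≢ : ∀ {m n} → m ≢ n → toNat (m ≡ᵇ n) ≡ 0
toNat-≡ᵇ-≢ {zero}  {zero}  0≢0     = contradiction refl 0≢0
toNat-≡ᵇ-≢ {zero}  {suc n} _       = refl
toNat-≡ᵇ-≢ {suc m} {zero}  _       = refl
toNat-≡ᵇ-≢ {suc m} {suc n} m+1≢n+1 = toNat-≡ᵇ-≢ (m+1≢n+1 ∘ cong suc)

δ-refl : ∀ q → δ q q ≡ 1
δ-refl (x , y) = cong₂ _*_ (toNat-≡ᵇ-refl x) (toNat-≡ᵇ-refl y)

δ-≢ : ∀ {q q′} → q ≢ q′ → δ q q′ ≡ 0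
δ-≢ {x , y} {x′ , y′} q≢q′ with x ≟ x′
... | no  x≢x′ = cong (_* toNat (y ≡ᵇ y′)) (toNat-≡ᵇ-≢ x≢x′)
... | yes refl =
  trans (cong (toNat (x ≡ᵇ x) *_) (toNat-≡ᵇ-≢ (q≢q′ ∘ cong (x ,_)))) (*-zeroʳ (toNat (x ≡ᵇ x)))

∑□-δ : ∀ m n {q} (f : ℕ × ℕ → ℕ) → proj₁ q < m → proj₂ q < n →
       ∑□ m n (λ q′ → δ q q′ * f q′) ≡ f q
∑□-δ m n {x₀ , y₀} f x₀<m y₀<n = begin
  ∑[ x ∈ upTo m ] ∑[ y ∈ upTo n ] (toNat (x₀ ≡ᵇ x) * toNat (y₀ ≡ᵇ y) * f (x , y))
    ≡⟨ ∑-cong (upTo m) (λ x → trans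
         (∑-cong (upTo n) (λ y → *-assoc (toNat (x₀ ≡ᵇ x)) _ _))
         (∑-*ˡ (upTo n) (toNat (x₀ ≡ᵇ x)) (λ y → toNat (y₀ ≡ᵇ y) * f (x , y)))) ⟩
  ∑[ x ∈ upTo m ] (toNat (x₀ ≡ᵇ x) * ∑[ y ∈ upTo n ] (toNat (y₀ ≡ᵇ y) * f (x , y)))
    ≡⟨ ∑-upTo-δ m _ x₀<m ⟩
  ∑[ y ∈ upTo n ] (toNat (y₀ ≡ᵇ y) * f (x₀ , y))
    ≡⟨ ∑-upTo-δ n _ y₀<n ⟩
  f (x₀ , y₀) ∎
  where open ≡-Reasoning

record Region : Set₁ where
  field
    Member   : ℕ × ℕ → Set
    member?  : ℕ × ℕ → Bool
    reflects : ∀ q → Reflects (Member q) (member? q)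
    width    : ℕ
    height   : ℕ
    bounded  : ∀ {q} → Member q → proj₁ q < width × proj₂ q < height

open Region public

∑ᴿ : Region → (ℕ × ℕ → ℕ) → ℕ
∑ᴿ R f = ∑□ (width R) (height R) (λ q → toNat (member? R q) * f q)

∑ᴿ-cong : ∀ R {f g : ℕ × ℕ → ℕ} → (∀ q → Member R q → f q ≡ g q) → ∑ᴿ R f ≡ ∑ᴿ R g
∑ᴿ-cong R {f} {g} f≗g = ∑□-cong (width R) (height R) pointwise
  where
  pointwise : ∀ q → toNat (member? R q) * f q ≡ toNat (member? R q) * g q
  pointwise q with member? R q | reflects R q
  ... | true  | ofʸ q∈R = cong (1 *_) (f≗g q q∈R)
  ... | false | ofⁿ _   = refl

∑ᴿ-+ : ∀ R (f g : ℕ × ℕ → ℕ) → ∑ᴿ R (λ q → f q + g q) ≡ ∑ᴿ R f + ∑ᴿ R g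
∑ᴿ-+ R f g = trans (∑□-cong (width R) (height R) (λ q → *-distribˡ-+ (toNat (member? R q)) (f q) (g q)))
                   (∑□-+ (width R) (height R) _ _)

column : Region → ℕ → ℕ
column R x = ∑[ y ∈ upTo (height R) ] toNat (member? R (x , y))

∑ᴿ-proj₁ : ∀ R → ∑ᴿ R proj₁ ≡ ∑[ x ∈ upTo (width R) ] (column R x * x)
∑ᴿ-proj₁ R = ∑-cong (upTo (width R)) (λ x → ∑-*ʳ (upTo (height R)) x (λ y → toNat (member? R (x , y))))

record IsMatching {A B : Set} (D : A → Set) (U : B → Set) (p : A → B) : Set where
  field
    into       : ∀ {d} → D d → U (p d)
    injective  : ∀ {d d′} → D d → D d′ → p d ≡ p d′ → d ≡ d′
    surjective : ∀ {u} → U u → Σ A λ d → D d × p d ≡ u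

module _ {A B C : Set} {D : A → Set} {E : B → Set} {F : C → Set} where

  IsMatching-∘ : ∀ {p : A → B} {q : B → C} →
                 IsMatching D E p → IsMatching E F q → IsMatching D F (q ∘ p)
  IsMatching-∘ {p} {q} P Q = record
    { into       = Q.into ∘ P.into
    ; injective  = λ d d′ eq → P.injective d d′ (Q.injective (P.into d) (P.into d′) eq)
    ; surjective = λ w → let (e , e∈E , qe≡w) = Q.surjective w
                             (d , d∈D , pd≡e) = P.surjective e∈E
                         in d , d∈D , trans (cong q pd≡e) qe≡w
    }
    where
    module P = IsMatching P
    module Q = IsMatching Q

IsMatching-cong : ∀ {D : A → Set} {U : B → Set} {p p′ : A → B} →
                  (∀ {d} → D d → p d ≡ p′ d) → IsMatching D U p → IsMatching D U p′
IsMatching-cong {U = U} p≗p′ P = record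
  { into       = λ d → subst U (p≗p′ d) (P.into d)
  ; injective  = λ d d′ eq → P.injective d d′ (trans (p≗p′ d) (trans eq (sym (p≗p′ d′))))
  ; surjective = λ u → let (d , d∈D , pd≡u) = P.surjective u in d , d∈D , trans (sym (p≗p′ d∈D)) pd≡u
  }
  where module P = IsMatching P

IsMatching-involution : ∀ {D U : A → Set} {s : A → A} →
  (∀ {d} → D d → U (s d)) → (∀ {u} → U u → D (s u)) →
  (∀ {d} → D d → s (s d) ≡ d) → (∀ {u} → U u → s (s u) ≡ u) → IsMatching D U s
IsMatching-involution {s = s} D→U U→D ss≗id-D ss≗id-U = record
  { into       = D→U
  ; injective  = λ d∈D d′∈D eq → trans (sym (ss≗id-D d∈D)) (trans (cong s eq) (ss≗id-D d′∈D))
  ; surjective = λ {u} u∈U → s u , U→D u∈U , ss≗id-U u∈U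
  }

module _ (R S : Region) {p : ℕ × ℕ → ℕ × ℕ} (P : IsMatching (Member R) (Member S) p) where

  open IsMatching P

  private
    fibre-size : ∀ {u} → Member S u → ∑ᴿ R (λ d → δ (p d) u) ≡ 1
    fibre-size {u} u∈S with surjective u∈S
    ... | d₀ , d₀∈R , pd₀≡u = begin
      ∑ᴿ R (λ d → δ (p d) u)
        ≡⟨ ∑□-cong (width R) (height R) only-d₀ ⟩
      ∑□ (width R) (height R) (λ d → δ d₀ d * 1)
        ≡⟨ ∑□-δ (width R) (height R) (λ _ → 1) (proj₁ d₀-bounded) (proj₂ d₀-bounded) ⟩
      1 ∎
      where
      open ≡-Reasoning
      d₀-bounded = bounded R d₀∈R
      only-d₀ : ∀ d → toNat (member? R d) * δ (p d) u ≡ δ d₀ d * 1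
      only-d₀ d with member? R d | reflects R d | ≡-dec _≟_ _≟_ d₀ d
      ... | true  | ofʸ _   | yes refl =
        trans (cong (λ v → 1 * δ v u) pd₀≡u)
              (trans (cong (1 *_) (δ-refl u)) (sym (cong (_* 1) (δ-refl d₀))))
      ... | true  | ofʸ d∈R | no d₀≢d  =
        trans (cong (1 *_) (δ-≢ λ pd≡u → d₀≢d (injective d₀∈R d∈R (trans pd₀≡u (sym pd≡u)))))
              (sym (cong (_* 1) (δ-≢ d₀≢d)))
      ... | false | ofⁿ d∉R | yes refl = contradiction d₀∈R d∉R
      ... | false | ofⁿ _   | no d₀≢d  = sym (cong (_* 1) (δ-≢ d₀≢d))

  ∑-matching : ∀ g → ∑ᴿ R (g ∘ p) ≡ ∑ᴿ S g
  ∑-matching g = begin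
    ∑ᴿ R (g ∘ p)
      ≡⟨ ∑□-cong (width R) (height R) (sym ∘ expand) ⟩
    ∑□ (width R) (height R) (λ d → ∑□ (width S) (height S) (W d))
      ≡⟨ ∑□-comm (width R) (height R) (width S) (height S) W ⟩
    ∑□ (width S) (height S) (λ u → ∑□ (width R) (height R) (λ d → W d u))
      ≡⟨ ∑□-cong (width S) (height S) collapse ⟩
    ∑ᴿ S g ∎
    where
    open ≡-Reasoning
    h : ℕ × ℕ → ℕ
    h u = toNat (member? S u) * g u
    W : ℕ × ℕ → ℕ × ℕ → ℕ
    W d u = toNat (member? R d) * (δ (p d) u * h u)
    expand : ∀ d → ∑□ (width S) (height S) (W d) ≡ toNat (member? R d) * g (p d)
    expand d with member? R d | reflects R d
    ... | false | ofⁿ _   = ∑□-*ˡ (width S) (height S) 0 (λ u → δ (p d) u * h u)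
    ... | true  | ofʸ d∈R = begin
      ∑□ (width S) (height S) (λ u → 1 * (δ (p d) u * h u))
        ≡⟨ ∑□-*ˡ (width S) (height S) 1 _ ⟩
      1 * ∑□ (width S) (height S) (λ u → δ (p d) u * h u)
        ≡⟨ cong (1 *_) (∑□-δ (width S) (height S) h pd<width pd<height) ⟩
      1 * (toNat (member? S (p d)) * g (p d))
        ≡⟨ cong (λ i → 1 * (i * g (p d))) pd∈S ⟩
      1 * (1 * g (p d))
        ≡⟨ cong (1 *_) (*-identityˡ (g (p d))) ⟩
      1 * g (p d) ∎
      where
      pd∈S = toNat-reflects-yes (reflects S (p d)) (into d∈R)
      pd<width = proj₁ (bounded S (into d∈R))
      pd<height = proj₂ (bounded S (into d∈R))
    collapse : ∀ u → ∑□ (width R) (height R) (λ d → W d u) ≡ h u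
    collapse u = begin
      ∑□ (width R) (height R) (λ d → W d u)
        ≡⟨ ∑□-cong (width R) (height R) (λ d → sym (*-assoc (toNat (member? R d)) _ _)) ⟩
      ∑□ (width R) (height R) (λ d → toNat (member? R d) * δ (p d) u * h u)
        ≡⟨ ∑□-*ʳ (width R) (height R) (h u) _ ⟩
      ∑ᴿ R (λ d → δ (p d) u) * h u
        ≡⟨ fibre-weighted ⟩
      h u ∎
      where
      fibre-weighted : ∑ᴿ R (λ d → δ (p d) u) * h u ≡ h u
      fibre-weighted with member? S u | reflects S u
      ... | true  | ofʸ u∈S = trans (cong (_* (1 * g u)) (fibre-size u∈S)) (*-identityˡ _)
      ... | false | ofⁿ _   = *-zeroʳ (∑ᴿ R (λ d → δ (p d) u))

upIn? : ℕ → ℕ → ℕ → ℕ → ℕ → Bool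
upIn? a b c u v =
  ⌊ a ≤? u + v ⌋ ∧ ⌊ suc u ≤? a + b ⌋ ∧ ⌊ suc v ≤? a + c ⌋ ∧ ⌊ suc (u + v) ≤? a + b + c ⌋

DownIn-reflects : ∀ a b c x y → Reflects (DownIn a b c x y) (downIn? a b c x y)
DownIn-reflects a b c x y =
  ⌊⌋-reflects (suc x ≤? a + b) ×-reflects ⌊⌋-reflects (suc y ≤? a + c) ×-reflects
  ⌊⌋-reflects (a ≤? suc (x + y)) ×-reflects ⌊⌋-reflects (suc (suc (x + y)) ≤? a + b + c)

UpIn-reflects : ∀ a b c u v → Reflects (UpIn a b c u v) (upIn? a b c u v)
UpIn-reflects a b c u v =
  ⌊⌋-reflects (a ≤? u + v) ×-reflects ⌊⌋-reflects (suc u ≤? a + b) ×-reflects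
  ⌊⌋-reflects (suc v ≤? a + c) ×-reflects ⌊⌋-reflects (suc (u + v) ≤? a + b + c)

downTriangles : ℕ → ℕ → ℕ → Region
downTriangles a b c = record
  { Member   = uncurry (DownIn a b c)
  ; member?  = uncurry (downIn? a b c)
  ; reflects = λ (x , y) → DownIn-reflects a b c x y
  ; width    = a + b
  ; height   = a + c
  ; bounded  = λ (x<a+b , y<a+c , _) → x<a+b , y<a+c
  }

upTriangles : ℕ → ℕ → ℕ → Region
upTriangles a b c = record
  { Member   = uncurry (UpIn a b c)
  ; member?  = uncurry (upIn? a b c)
  ; reflects = λ (u , v) → UpIn-reflects a b c u v
  ; width    = a + b
  ; height   = a + c
  ; bounded  = λ (_ , u<a+b , v<a+c , _) → u<a+b , v<a+c
  }

partnerOf : Grid → ℕ × ℕ → ℕ × ℕ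
partnerOf T (x , y) = partner (T x y) x y

module _ {a b c : ℕ} {T : Grid} where

  IsTiling⇒IsMatching : IsTiling a b c T →
    IsMatching (Member (downTriangles a b c)) (Member (upTriangles a b c)) (partnerOf T)
  IsTiling⇒IsMatching (matched , injective , covered) = record
    { into       = λ {(x , y)} Δ∈H → let (u , v , eq , ∇∈H) = matched x y Δ∈H
                                    in subst (uncurry (UpIn a b c)) (sym eq) ∇∈H
    ; injective  = λ {(x , y)} {(x′ , y′)} → injective x y x′ y′
    ; surjective = λ {(u , v)} ∇∈H → let (x , y , Δ∈H , eq) = covered u v ∇∈H in (x , y) , Δ∈H , eq
    }

  IsMatching⇒IsTiling : IsMatching (Member (downTriangles a b c)) (Member (upTriangles a b c)) (partnerOf T) →
    IsTiling a b c T
  IsMatching⇒IsTiling M =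
      (λ x y Δ∈H → proj₁ (partnerOf T (x , y)) , proj₂ (partnerOf T (x , y)) , refl , into Δ∈H)
    , (λ x y x′ y′ → injective)
    , (λ u v ∇∈H → let ((x , y) , Δ∈H , eq) = surjective ∇∈H in x , y , Δ∈H , eq)
    where open IsMatching M

-- Counting right edges

m+n≡o+p⇒p≤n⇒m≤o : ∀ {m n o p} → m + n ≡ o + p → p ≤ n → m ≤ o
m+n≡o+p⇒p≤n⇒m≤o {m} {n} {o} {p} m+n≡o+p p≤n =
  +-cancelʳ-≤ n m o (subst (_≤ o + n) (sym m+n≡o+p) (+-monoʳ-≤ o p≤n))

-- In each column, U(x, y+1) lies in H exactly when Δ(x, y) does; unpaired are only the
-- up triangles U(x, 0) with a ≤ x < a+b and the down triangles Δ(x, a+c−1) with x < b.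
module _ (a′ b c : ℕ) where

  private
    a n : ℕ
    a = suc a′
    n = a′ + c

    Up Dn : ℕ → ℕ → ℕ
    Up u v = toNat (upIn? a b c u v)
    Dn x y = toNat (downIn? a b c x y)

    b+n≡a′+b+c : b + n ≡ a′ + b + c
    b+n≡a′+b+c = trans (sym (+-assoc b a′ c)) (cong (_+ c) (+-comm b a′))

    upIn-suc : ∀ x y → y < n → Up x (suc y) ≡ Dn x y
    upIn-suc x y y<n =
      cong toNat (reflects-⇔ (UpIn-reflects a b c x (suc y)) (DownIn-reflects a b c x y) (mk⇔ to from))
      where
      to : UpIn a b c x (suc y) → DownIn a b c x y
      to (a≤x+y+1 , x<a+b , y+1<a+c , x+y+1<K) =
          x<a+b
        , ≤-trans (n≤1+n _) y+1<a+c
        , subst (a ≤_) (+-suc x y) a≤x+y+1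
        , subst (λ z → suc z ≤ a + b + c) (+-suc x y) x+y+1<K
      from : DownIn a b c x y → UpIn a b c x (suc y)
      from (x<a+b , _ , a≤x+y+1 , x+y+1<K) =
          subst (a ≤_) (sym (+-suc x y)) a≤x+y+1
        , x<a+b
        , s≤s y<n
        , subst (λ z → suc z ≤ a + b + c) (sym (+-suc x y)) x+y+1<K

    column-balance : ∀ x → column (upTriangles a b c) x + Dn x n ≡ Up x 0 + column (downTriangles a b c) x
    column-balance x = begin
      ∑[ y ∈ upTo (suc n) ] Up x y + Dn x n           ≡⟨ cong (_+ Dn x n) (∑-upTo-suc n (Up x)) ⟩
      Up x 0 + ∑[ y ∈ upTo n ] Up x (suc y) + Dn x n  ≡⟨ cong (λ s → Up x 0 + s + Dn x n)
                                                              (∑-upTo-cong n (upIn-suc x)) ⟩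
      Up x 0 + ∑[ y ∈ upTo n ] Dn x y + Dn x n        ≡⟨ +-assoc (Up x 0) _ _ ⟩
      Up x 0 + (∑[ y ∈ upTo n ] Dn x y + Dn x n)      ≡⟨ cong (Up x 0 +_) (∑-upTo-∷ʳ n (Dn x)) ⟨
      Up x 0 + ∑[ y ∈ upTo (suc n) ] Dn x y           ∎
      where open ≡-Reasoning

    bottom-row-off : ∀ x → x < a → Up x 0 ≡ 0
    bottom-row-off x x<a = toNat-reflects-no (UpIn-reflects a b c x 0)
      λ (a≤x+0 , _) → <⇒≱ x<a (subst (a ≤_) (+-identityʳ x) a≤x+0)

    bottom-row-on : ∀ i → i < b → Up (a + i) 0 ≡ 1
    bottom-row-on i i<b = toNat-reflects-yes (UpIn-reflects a b c (a + i) 0)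
      ( subst (a ≤_) (sym (+-identityʳ (a + i))) (m≤m+n a i)
      , a+i<a+b
      , s≤s z≤n
      , subst (λ z → suc z ≤ a + b + c) (sym (+-identityʳ (a + i))) (≤-trans a+i<a+b (m≤m+n (a + b) c)) )
      where
      a+i<a+b : a + i < a + b
      a+i<a+b = subst (_≤ a + b) (+-suc a i) (+-monoʳ-≤ a i<b)

    top-row-on : ∀ x → x < b → Dn x n ≡ 1
    top-row-on x x<b = toNat-reflects-yes (DownIn-reflects a b c x n)
      ( ≤-trans x<b (m≤n+m b a)
      , ≤-refl
      , s≤s (≤-trans (m≤m+n a′ c) (m≤n+m n x))
      , s≤s (subst (suc (x + n) ≤_) b+n≡a′+b+c (+-monoˡ-≤ n x<b)) )

    top-row-off : ∀ i → Dn (b + i) n ≡ 0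
    top-row-off i = toNat-reflects-no (DownIn-reflects a b c (b + i) n)
      λ (_ , _ , _ , b+i+n+2≤K) →
        <⇒≱ (s≤s⁻¹ b+i+n+2≤K) (subst (_≤ b + i + n) b+n≡a′+b+c (+-monoˡ-≤ n (m≤m+n b i)))

    bottom-row : ∑[ x ∈ upTo (a + b) ] (Up x 0 * x) ≡ b * a + ∑[ i ∈ upTo b ] i
    bottom-row = begin
      ∑[ x ∈ upTo (a + b) ] (Up x 0 * x)
        ≡⟨ ∑-upTo-+ a b (λ x → Up x 0 * x) ⟩
      ∑[ x ∈ upTo a ] (Up x 0 * x) + ∑[ i ∈ upTo b ] (Up (a + i) 0 * (a + i))
        ≡⟨ cong₂ _+_ (∑-upTo-zero a _ (λ x x<a → cong (_* x) (bottom-row-off x x<a)))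
                     (∑-upTo-cong b (λ i i<b →
                       trans (cong (_* (a + i)) (bottom-row-on i i<b)) (*-identityˡ (a + i)))) ⟩
      ∑[ i ∈ upTo b ] (a + i)
        ≡⟨ ∑-+ (upTo b) (λ _ → a) (λ i → i) ⟩
      ∑[ i ∈ upTo b ] a + ∑[ i ∈ upTo b ] i
        ≡⟨ cong (_+ ∑[ i ∈ upTo b ] i) (trans (∑-const (upTo b) a) (cong (_* a) (length-upTo b))) ⟩
      b * a + ∑[ i ∈ upTo b ] i ∎
      where open ≡-Reasoning

    top-row : ∑[ x ∈ upTo (a + b) ] (Dn x n * x) ≡ ∑[ i ∈ upTo b ] i
    top-row = begin
      ∑[ x ∈ upTo (a + b) ] (Dn x n * x)
        ≡⟨ cong (λ m → ∑[ x ∈ upTo m ] (Dn x n * x)) (+-comm a b) ⟩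
      ∑[ x ∈ upTo (b + a) ] (Dn x n * x)
        ≡⟨ ∑-upTo-+ b a (λ x → Dn x n * x) ⟩
      ∑[ x ∈ upTo b ] (Dn x n * x) + ∑[ i ∈ upTo a ] (Dn (b + i) n * (b + i))
        ≡⟨ cong₂ _+_ (∑-upTo-cong b (λ x x<b → trans (cong (_* x) (top-row-on x x<b)) (*-identityˡ x)))
                     (∑-upTo-zero a _ (λ i _ → cong (_* (b + i)) (top-row-off i))) ⟩
      ∑[ i ∈ upTo b ] i + 0
        ≡⟨ +-identityʳ _ ⟩
      ∑[ i ∈ upTo b ] i ∎
      where open ≡-Reasoning

  ∑proj₁-upTriangles : ∑ᴿ (upTriangles a b c) proj₁ ≡ a * b + ∑ᴿ (downTriangles a b c) proj₁
  ∑proj₁-upTriangles = +-cancelʳ-≡ (∑[ i ∈ upTo b ] i) _ _ (begin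
    ∑ᴿ (upTriangles a b c) proj₁ + ∑[ i ∈ upTo b ] i
      ≡⟨ cong₂ _+_ (∑ᴿ-proj₁ (upTriangles a b c)) (sym top-row) ⟩
    ∑[ x ∈ upTo (a + b) ] (colU x * x) + ∑[ x ∈ upTo (a + b) ] (Dn x n * x)
      ≡⟨ ∑-+ (upTo (a + b)) (λ x → colU x * x) (λ x → Dn x n * x) ⟨
    ∑[ x ∈ upTo (a + b) ] (colU x * x + Dn x n * x)
      ≡⟨ ∑-cong (upTo (a + b)) balance ⟩
    ∑[ x ∈ upTo (a + b) ] (Up x 0 * x + colD x * x)
      ≡⟨ ∑-+ (upTo (a + b)) (λ x → Up x 0 * x) (λ x → colD x * x) ⟩
    ∑[ x ∈ upTo (a + b) ] (Up x 0 * x) + ∑[ x ∈ upTo (a + b) ] (colD x * x)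
      ≡⟨ cong₂ _+_ bottom-row (sym (∑ᴿ-proj₁ (downTriangles a b c))) ⟩
    b * a + ∑[ i ∈ upTo b ] i + ∑ᴿ (downTriangles a b c) proj₁
      ≡⟨ rearrange (∑[ i ∈ upTo b ] i) (∑ᴿ (downTriangles a b c) proj₁) ⟩
    a * b + ∑ᴿ (downTriangles a b c) proj₁ + ∑[ i ∈ upTo b ] i ∎)
    where
    open ≡-Reasoning
    colU colD : ℕ → ℕ
    colU = column (upTriangles a b c)
    colD = column (downTriangles a b c)
    balance : ∀ x → colU x * x + Dn x n * x ≡ Up x 0 * x + colD x * x
    balance x = begin
      colU x * x + Dn x n * x  ≡⟨ *-distribʳ-+ x (colU x) (Dn x n) ⟨
      (colU x + Dn x n) * x    ≡⟨ cong (_* x) (column-balance x) ⟩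
      (Up x 0 + colD x) * x    ≡⟨ *-distribʳ-+ x (Up x 0) (colD x) ⟩
      Up x 0 * x + colD x * x  ∎
    rearrange : ∀ t d → b * a + t + d ≡ a * b + d + t
    rearrange t d = begin
      b * a + t + d    ≡⟨ +-assoc (b * a) t d ⟩
      b * a + (t + d)  ≡⟨ cong₂ _+_ (*-comm b a) (+-comm t d) ⟩
      a * b + (d + t)  ≡⟨ +-assoc (a * b) d t ⟨
      a * b + d + t    ∎

count : (Dir → Bool) → ℕ → ℕ → ℕ → Grid → ℕ
count P a b c T = ∑ᴿ (downTriangles a b c) (λ (x , y) → toNat (P (T x y)))

partner-x : ∀ d x y → proj₁ (partner d x y) ≡ toNat (isRight d) + x
partner-x top   x y = refl
partner-x left  x y = refl
partner-x right x y = refl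

count-right : ∀ {a b c T} → 1 ≤ a → IsTiling a b c T → count isRight a b c T ≡ a * b
count-right {suc a′} {b} {c} {T} _ T-tiles = +-cancelʳ-≡ (∑ᴿ ▽ proj₁) _ _ (begin
  count isRight a b c T + ∑ᴿ ▽ proj₁
    ≡⟨ ∑ᴿ-+ ▽ (λ (x , y) → toNat (isRight (T x y))) proj₁ ⟨
  ∑ᴿ ▽ (λ (x , y) → toNat (isRight (T x y)) + x)
    ≡⟨ ∑ᴿ-cong ▽ (λ (x , y) _ → sym (partner-x (T x y) x y)) ⟩
  ∑ᴿ ▽ (proj₁ ∘ partnerOf T)
    ≡⟨ ∑-matching ▽ △ (IsTiling⇒IsMatching T-tiles) proj₁ ⟩
  ∑ᴿ △ proj₁
    ≡⟨ ∑proj₁-upTriangles a′ b c ⟩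
  a * b + ∑ᴿ ▽ proj₁ ∎)
  where
  open ≡-Reasoning
  a = suc a′
  ▽ = downTriangles a b c
  △ = upTriangles a b c

-- The reflection ψ

-- ψ acts on triangles through reflect (a+b+c): Δ(x,y) ↦ Δ(a+b+c−x−y−2, y) with s = 2, and
-- U(u,v) ↦ U(a+b+c−u−v−1, v) with s = 1.
reflect : ℕ → ℕ → ℕ × ℕ → ℕ × ℕ
reflect K s (x , y) = K ∸ (x + y + s) , y

m+n≡o⇒o∸n≡m : ∀ {m n o} → m + n ≡ o → o ∸ n ≡ m
m+n≡o⇒o∸n≡m {m} {n} refl = m+n∸n≡m m n

reflect-mirror : ∀ {K s x y} → x + y + s ≤ K → x + (proj₁ (reflect K s (x , y)) + y + s) ≡ K
reflect-mirror {K} {s} {x} {y} x+y+s≤K = trans (shuffle x (K ∸ (x + y + s)) y s) (m∸n+n≡m x+y+s≤K)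
  where
  shuffle : ∀ x x′ y s → x + (x′ + y + s) ≡ x′ + (x + y + s)
  shuffle = solve-∀

reflect-involutive : ∀ {K s x y} → x + y + s ≤ K → reflect K s (reflect K s (x , y)) ≡ (x , y)
reflect-involutive {K} {s} {x} {y} x+y+s≤K =
  cong (_, y) (m+n≡o⇒o∸n≡m (reflect-mirror {K} {s} {x} {y} x+y+s≤K))

a+b+c≡c+b+a : ∀ a b c → a + b + c ≡ c + b + a
a+b+c≡c+b+a = solve-∀

DownIn-bound : ∀ {a b c K x y} → a + b + c ≡ K → DownIn a b c x y → x + y + 2 ≤ K
DownIn-bound {a} {b} {c} {x = x} {y} refl (_ , _ , _ , x+y+2≤K) = subst (_≤ a + b + c) (+-comm 2 (x + y)) x+y+2≤K

UpIn-bound : ∀ {a b c K u v} → a + b + c ≡ K → UpIn a b c u v → u + v + 1 ≤ K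
UpIn-bound {a} {b} {c} {u = u} {v} refl (_ , _ , _ , u+v+1≤K) = subst (_≤ a + b + c) (+-comm 1 (u + v)) u+v+1≤K

module _ {a b c K : ℕ} (a+b+c≡K : a + b + c ≡ K) where

  private
    K≡c+b+a : K ≡ c + b + a
    K≡c+b+a = trans (sym a+b+c≡K) (a+b+c≡c+b+a a b c)

    c+[a+b]≡K : c + (a + b) ≡ K
    c+[a+b]≡K = trans (+-comm c (a + b)) a+b+c≡K

  DownIn-reflect : ∀ {x y} → DownIn a b c x y → uncurry (DownIn c b a) (reflect K 2 (x , y))
  DownIn-reflect {x} {y} Δ@(x<a+b , y<a+c , a≤x+y+1 , _) =
      m+n≡o+p⇒p≤n⇒m≤o (trans (r₁ x′ x y) (trans x′+x+y+2≡K K≡c+b+a)) a≤x+y+1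
    , subst (suc y ≤_) (+-comm a c) y<a+c
    , m+n≡o+p⇒p≤n⇒m≤o (trans c+[a+b]≡K (trans (sym x′+x+y+2≡K) (r₂ x′ x y))) x<a+b
    , subst (suc (suc (x′ + y)) ≤_) (trans (r₃ x′ x y) (trans x′+x+y+2≡K K≡c+b+a)) (m≤m+n _ x)
    where
    x′ = K ∸ (x + y + 2)
    x′+x+y+2≡K : x′ + (x + y + 2) ≡ K
    x′+x+y+2≡K = m∸n+n≡m (DownIn-bound a+b+c≡K Δ)
    r₁ : ∀ x′ x y → suc x′ + suc (x + y) ≡ x′ + (x + y + 2)
    r₁ = solve-∀
    r₂ : ∀ x′ x y → x′ + (x + y + 2) ≡ suc (x′ + y) + suc x
    r₂ = solve-∀
    r₃ : ∀ x′ x y → suc (suc (x′ + y)) + x ≡ x′ + (x + y + 2)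
    r₃ = solve-∀

  UpIn-reflect : ∀ {u v} → UpIn a b c u v → uncurry (UpIn c b a) (reflect K 1 (u , v))
  UpIn-reflect {u} {v} ∇@(a≤u+v , u<a+b , v<a+c , _) =
      m+n≡o+p⇒p≤n⇒m≤o (trans c+[a+b]≡K (trans (sym u′+u+v+1≡K) (r₁ u′ u v))) u<a+b
    , m+n≡o+p⇒p≤n⇒m≤o (trans (r₂ u′ u v) (trans u′+u+v+1≡K K≡c+b+a)) a≤u+v
    , subst (suc v ≤_) (+-comm a c) v<a+c
    , subst (suc (u′ + v) ≤_) (trans (r₃ u′ u v) (trans u′+u+v+1≡K K≡c+b+a)) (m≤m+n _ u)
    where
    u′ = K ∸ (u + v + 1)
    u′+u+v+1≡K : u′ + (u + v + 1) ≡ K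
    u′+u+v+1≡K = m∸n+n≡m (UpIn-bound a+b+c≡K ∇)
    r₁ : ∀ u′ u v → u′ + (u + v + 1) ≡ u′ + v + suc u
    r₁ = solve-∀
    r₂ : ∀ u′ u v → suc u′ + (u + v) ≡ u′ + (u + v + 1)
    r₂ = solve-∀
    r₃ : ∀ u′ u v → suc (u′ + v) + u ≡ u′ + (u + v + 1)
    r₃ = solve-∀

reflect-downTriangles : ∀ {a b c K} → a + b + c ≡ K →
  IsMatching (Member (downTriangles a b c)) (Member (downTriangles c b a)) (reflect K 2)
reflect-downTriangles {a} {b} {c} a+b+c≡K = IsMatching-involution
  (DownIn-reflect a+b+c≡K) (DownIn-reflect c+b+a≡K)
  (reflect-involutive ∘ DownIn-bound a+b+c≡K) (reflect-involutive ∘ DownIn-bound c+b+a≡K)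
  where c+b+a≡K = trans (a+b+c≡c+b+a c b a) a+b+c≡K

reflect-upTriangles : ∀ {a b c K} → a + b + c ≡ K →
  IsMatching (Member (upTriangles a b c)) (Member (upTriangles c b a)) (reflect K 1)
reflect-upTriangles {a} {b} {c} a+b+c≡K = IsMatching-involution
  (UpIn-reflect a+b+c≡K) (UpIn-reflect c+b+a≡K)
  (reflect-involutive ∘ UpIn-bound a+b+c≡K) (reflect-involutive ∘ UpIn-bound c+b+a≡K)
  where c+b+a≡K = trans (a+b+c≡c+b+a c b a) a+b+c≡K

partner-reflect : ∀ {K x′} d x y → x′ + (x + y + 2) ≡ K →
                  partner (swapLR d) x′ y ≡ reflect K 1 (partner d x y)
partner-reflect {x′ = x′} top x y x′+x+y+2≡K =
  cong (_, suc y) (sym (m+n≡o⇒o∸n≡m (trans (r x′ x y) x′+x+y+2≡K)))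
  where
  r : ∀ x′ x y → x′ + (x + suc y + 1) ≡ x′ + (x + y + 2)
  r = solve-∀
partner-reflect {x′ = x′} left x y x′+x+y+2≡K =
  cong (_, y) (sym (m+n≡o⇒o∸n≡m (trans (r x′ x y) x′+x+y+2≡K)))
  where
  r : ∀ x′ x y → suc x′ + (x + y + 1) ≡ x′ + (x + y + 2)
  r = solve-∀
partner-reflect {x′ = x′} right x y x′+x+y+2≡K =
  cong (_, y) (sym (m+n≡o⇒o∸n≡m (trans (r x′ x y) x′+x+y+2≡K)))
  where
  r : ∀ x′ x y → x′ + (suc x + y + 1) ≡ x′ + (x + y + 2)
  r = solve-∀

swapLR-involutive : ∀ d → swapLR (swapLR d) ≡ d
swapLR-involutive top   = refl
swapLR-involutive left  = refl
swapLR-involutive right = refl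

∑-reflect : ∀ a b c f →
            ∑ᴿ (downTriangles c b a) f ≡ ∑ᴿ (downTriangles a b c) (f ∘ reflect (a + b + c) 2)
∑-reflect a b c f = sym (∑-matching (downTriangles a b c) (downTriangles c b a) (reflect-downTriangles refl) f)

module _ {a b c : ℕ} where

  ψ-reflect : ∀ T {x y} → DownIn a b c x y →
              uncurry (ψ a b c T) (reflect (a + b + c) 2 (x , y)) ≡ swapLR (T x y)
  ψ-reflect T Δ = cong (swapLR ∘ uncurry T) (reflect-involutive (DownIn-bound refl Δ))

  ψ-involutive : ∀ T {x y} → DownIn a b c x y → ψ c b a (ψ a b c T) x y ≡ T x y
  ψ-involutive T {x} {y} Δ = begin
    swapLR (uncurry (ψ a b c T) (reflect (c + b + a) 2 (x , y)))
      ≡⟨ cong (λ K → swapLR (uncurry (ψ a b c T) (reflect K 2 (x , y)))) (a+b+c≡c+b+a a b c) ⟨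
    swapLR (uncurry (ψ a b c T) (reflect (a + b + c) 2 (x , y)))
      ≡⟨ cong swapLR (ψ-reflect T Δ) ⟩
    swapLR (swapLR (T x y))
      ≡⟨ swapLR-involutive (T x y) ⟩
    T x y ∎
    where open ≡-Reasoning

  ψ-cong : ∀ {T T′} → (∀ {x y} → DownIn a b c x y → T x y ≡ T′ x y) →
           ∀ {x y} → DownIn c b a x y → ψ a b c T x y ≡ ψ a b c T′ x y
  ψ-cong T≗T′ Δ = cong swapLR (T≗T′ (DownIn-reflect (a+b+c≡c+b+a c b a) Δ))

  ψ-tiling : ∀ {T} → IsTiling a b c T → IsTiling c b a (ψ a b c T)
  ψ-tiling {T} T-tiles = IsMatching⇒IsTiling (IsMatching-cong reflected-partner
    (IsMatching-∘ (IsMatching-∘ (reflect-downTriangles (a+b+c≡c+b+a c b a)) (IsTiling⇒IsMatching T-tiles))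
                  (reflect-upTriangles refl)))
    where
    K = a + b + c
    reflected-partner : ∀ {q} → Member (downTriangles c b a) q →
                        reflect K 1 (partnerOf T (reflect K 2 q)) ≡ partnerOf (ψ a b c T) q
    reflected-partner {x′ , y} Δ′ = sym (partner-reflect (T x y) x y
      (reflect-mirror {K} {2} {x′} {y} (DownIn-bound (sym (a+b+c≡c+b+a a b c)) Δ′)))
      where x = proj₁ (reflect K 2 (x′ , y))

module _ {a b c k : ℕ} where

  Φ-tiling : ∀ {T} → IsKTiling a b c k T → IsKTiling c b a k (Φ a b c k T)
  Φ-tiling T-tiles i = ψ-tiling (T-tiles (opposite i))

  Φ-involutive : ∀ T → SameKT a b c k (Φ c b a k (Φ a b c k T)) T
  Φ-involutive T i x y Δ =
    trans (ψ-involutive (T (opposite (opposite i))) Δ) (cong (λ j → T j x y) (opposite-involutive i))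

  Φ-cong : ∀ {T T′} → SameKT a b c k T T′ → SameKT c b a k (Φ a b c k T) (Φ a b c k T′)
  Φ-cong T≈T′ i x y = ψ-cong (T≈T′ (opposite i) _ _)

-- Interactions

isLeft : Dir → Bool
isLeft left = true
isLeft _    = false

isLeftOrTop : Dir → Bool
isLeftOrTop right = false
isLeftOrTop _     = true

isRight-swapLR : ∀ d → isRight (swapLR d) ≡ isLeft d
isRight-swapLR top   = refl
isRight-swapLR left  = refl
isRight-swapLR right = refl

isRightOrTop-swapLR : ∀ d → isRightOrTop (swapLR d) ≡ isLeftOrTop d
isRightOrTop-swapLR top   = refl
isRightOrTop-swapLR left  = refl
isRightOrTop-swapLR right = refl

count₂ : (Dir → Bool) → (Dir → Bool) → ℕ → ℕ → ℕ → Grid → Grid → ℕ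
count₂ P Q a b c T₁ T₂ = ∑ᴿ (downTriangles a b c) (λ (x , y) → toNat (P (T₁ x y)) * toNat (Q (T₂ x y)))

module _ (a b c : ℕ) where

  count-ψ : ∀ P T → count P c b a (ψ a b c T) ≡ count (P ∘ swapLR) a b c T
  count-ψ P T = trans (∑-reflect a b c (λ (x , y) → toNat (P (ψ a b c T x y))))
    (∑ᴿ-cong (downTriangles a b c) (λ (x , y) Δ → cong (toNat ∘ P) (ψ-reflect T Δ)))

  count₂-ψ : ∀ P Q T₁ T₂ →
    count₂ P Q c b a (ψ a b c T₁) (ψ a b c T₂) ≡ count₂ (P ∘ swapLR) (Q ∘ swapLR) a b c T₁ T₂
  count₂-ψ P Q T₁ T₂ = trans
    (∑-reflect a b c (λ (x , y) → toNat (P (ψ a b c T₁ x y)) * toNat (Q (ψ a b c T₂ x y))))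
    (∑ᴿ-cong (downTriangles a b c)
      (λ (x , y) Δ →
        cong₂ (λ d₁ d₂ → toNat (P d₁) * toNat (Q d₂)) (ψ-reflect T₁ Δ) (ψ-reflect T₂ Δ)))

count-left : ∀ {a b c T} → 1 ≤ c → IsTiling a b c T → count isLeft a b c T ≡ c * b
count-left {a} {b} {c} {T} 1≤c T-tiles = begin
  count isLeft a b c T
    ≡⟨ ∑ᴿ-cong (downTriangles a b c) (λ (x , y) _ → cong toNat (isRight-swapLR (T x y))) ⟨
  count (isRight ∘ swapLR) a b c T
    ≡⟨ count-ψ a b c isRight T ⟨
  count isRight c b a (ψ a b c T)
    ≡⟨ count-right 1≤c (ψ-tiling T-tiles) ⟩
  c * b ∎
  where open ≡-Reasoning

lozenge-balance : ∀ d₁ d₂ →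
  toNat (isLeftOrTop d₁) * toNat (isLeft d₂) + toNat (isRight d₁)
    ≡ toNat (isRight d₁) * toNat (isRightOrTop d₂) + toNat (isLeft d₂)
lozenge-balance top   top   = refl
lozenge-balance top   left  = refl
lozenge-balance top   right = refl
lozenge-balance left  top   = refl
lozenge-balance left  left  = refl
lozenge-balance left  right = refl
lozenge-balance right top   = refl
lozenge-balance right left  = refl
lozenge-balance right right = refl

pair-balance : ∀ {a b c T₁ T₂} → 1 ≤ a → 1 ≤ c → IsTiling a b c T₁ → IsTiling a b c T₂ →
  count₂ isLeftOrTop isLeft a b c T₁ T₂ + a * b ≡ count₂ isRight isRightOrTop a b c T₁ T₂ + b * c
pair-balance {a} {b} {c} {T₁} {T₂} 1≤a 1≤c T₁-tiles T₂-tiles = begin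
  LL + a * b                    ≡⟨ cong (LL +_) (count-right 1≤a T₁-tiles) ⟨
  LL + count isRight a b c T₁   ≡⟨ ∑ᴿ-+ ▽ ll (λ (x , y) → toNat (isRight (T₁ x y))) ⟨
  ∑ᴿ ▽ (λ q → ll q + toNat (isRight (uncurry T₁ q)))
    ≡⟨ ∑ᴿ-cong ▽ (λ (x , y) _ → lozenge-balance (T₁ x y) (T₂ x y)) ⟩
  ∑ᴿ ▽ (λ q → rr q + toNat (isLeft (uncurry T₂ q)))
    ≡⟨ ∑ᴿ-+ ▽ rr (λ (x , y) → toNat (isLeft (T₂ x y))) ⟩
  RR + count isLeft a b c T₂    ≡⟨ cong (RR +_) (trans (count-left 1≤c T₂-tiles) (*-comm c b)) ⟩
  RR + b * c                    ∎
  where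
  open ≡-Reasoning
  ▽ = downTriangles a b c
  ll rr : ℕ × ℕ → ℕ
  ll (x , y) = toNat (isLeftOrTop (T₁ x y)) * toNat (isLeft (T₂ x y))
  rr (x , y) = toNat (isRight (T₁ x y)) * toNat (isRightOrTop (T₂ x y))
  LL = count₂ isLeftOrTop isLeft a b c T₁ T₂
  RR = count₂ isRight isRightOrTop a b c T₁ T₂

interactions-∑pairs : ∀ a b c k T →
  interactions a b c k T ≡ ∑pairs k (λ α β → count₂ isRight isRightOrTop a b c (T α) (T β))
interactions-∑pairs a b c k T = ∑-cong (allFin k) λ α → ∑-cong (allFin k) λ β → trans
  (∑□-cong (a + b) (a + c) (λ (x , y) →
    toNat-∧⁴ ⌊ toℕ α <? toℕ β ⌋ (downIn? a b c x y) (isRight (T α x y)) (isRightOrTop (T β x y))))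
  (∑□-*ˡ (a + b) (a + c) (ordered α β)
    (λ (x , y) → toNat (downIn? a b c x y) * (toNat (isRight (T α x y)) * toNat (isRightOrTop (T β x y)))))
  where
  toNat-∧⁴ : ∀ p q r s → toNat (p ∧ q ∧ r ∧ s) ≡ toNat p * (toNat q * (toNat r * toNat s))
  toNat-∧⁴ p q r s =
    trans (toNat-∧ p (q ∧ r ∧ s))
          (cong (toNat p *_) (trans (toNat-∧ q (r ∧ s)) (cong (toNat q *_) (toNat-∧ r s))))

interactions-Φ : ∀ a b c k T →
  interactions c b a k (Φ a b c k T) ≡ ∑pairs k (λ γ δ → count₂ isLeftOrTop isLeft a b c (T γ) (T δ))
interactions-Φ a b c k T = begin
  interactions c b a k (Φ a b c k T)
    ≡⟨ interactions-∑pairs c b a k (Φ a b c k T) ⟩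
  ∑pairs k (λ α β → count₂ isRight isRightOrTop c b a (ψ a b c (T (opposite α)))
                                                     (ψ a b c (T (opposite β))))
    ≡⟨ ∑pairs-cong k (λ α β → trans (count₂-ψ a b c isRight isRightOrTop (T (opposite α)) (T (opposite β)))
                                    (swapped (T (opposite α)) (T (opposite β)))) ⟩
  ∑pairs k (λ α β → count₂ isLeftOrTop isLeft a b c (T (opposite β)) (T (opposite α)))
    ≡⟨ ∑pairs-opposite k (λ γ δ → count₂ isLeftOrTop isLeft a b c (T γ) (T δ)) ⟩
  ∑pairs k (λ γ δ → count₂ isLeftOrTop isLeft a b c (T γ) (T δ)) ∎
  where
  open ≡-Reasoning
  swapped : ∀ T₁ T₂ →
    count₂ (isRight ∘ swapLR) (isRightOrTop ∘ swapLR) a b c T₁ T₂ ≡ count₂ isLeftOrTop isLeft a b c T₂ T₁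
  swapped T₁ T₂ = ∑ᴿ-cong (downTriangles a b c) λ (x , y) _ → trans
    (cong₂ (λ p q → toNat p * toNat q) (isRight-swapLR (T₁ x y)) (isRightOrTop-swapLR (T₂ x y)))
    (*-comm (toNat (isLeft (T₁ x y))) (toNat (isLeftOrTop (T₂ x y))))

interactions-Φ-shift : ∀ {a b c k T} → 1 ≤ a → 1 ≤ c → IsKTiling a b c k T →
  interactions c b a k (Φ a b c k T) + (k C 2) * (a * b) ≡ interactions a b c k T + (k C 2) * (b * c)
interactions-Φ-shift {a} {b} {c} {k} {T} 1≤a 1≤c T-tiles = begin
  interactions c b a k (Φ a b c k T) + (k C 2) * (a * b)
    ≡⟨ cong₂ _+_ (interactions-Φ a b c k T) (sym (∑pairs-const k (a * b))) ⟩
  ∑pairs k (λ γ δ → count₂ isLeftOrTop isLeft a b c (T γ) (T δ)) + ∑pairs k (λ _ _ → a * b)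
    ≡⟨ ∑pairs-+ k _ _ ⟨
  ∑pairs k (λ γ δ → count₂ isLeftOrTop isLeft a b c (T γ) (T δ) + a * b)
    ≡⟨ ∑pairs-cong k (λ γ δ → pair-balance 1≤a 1≤c (T-tiles γ) (T-tiles δ)) ⟩
  ∑pairs k (λ γ δ → count₂ isRight isRightOrTop a b c (T γ) (T δ) + b * c)
    ≡⟨ ∑pairs-+ k _ _ ⟩
  ∑pairs k (λ γ δ → count₂ isRight isRightOrTop a b c (T γ) (T δ)) + ∑pairs k (λ _ _ → b * c)
    ≡⟨ cong₂ _+_ (sym (interactions-∑pairs a b c k T)) (∑pairs-const k (b * c)) ⟩
  interactions a b c k T + (k C 2) * (b * c) ∎
  where open ≡-Reasoning

-- Imported only here: ℤ's prefix +_ would make the sections (n +_) above ambiguous.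
open import Data.Integer using (ℤ; +_; _-_) renaming (_+_ to _+ℤ_; _*_ to _*ℤ_)
open import Data.Integer.Properties using (pos-+; pos-*)
import Data.Integer.Tactic.RingSolver as ℤ-Solver

m+p*x≡n+p*y⇒m≡p*[y-x]+n : ∀ m n p x y → m + p * x ≡ n + p * y → + m ≡ (+ p) *ℤ (+ y - + x) +ℤ + n
m+p*x≡n+p*y⇒m≡p*[y-x]+n m n p x y m+px≡n+py = begin
  + m                              ≡⟨ cancel (+ m) (+ p *ℤ + x) ⟩
  + m +ℤ + p *ℤ + x - + p *ℤ + x   ≡⟨ cong (_- + p *ℤ + x) (embed m x) ⟩
  + (m + p * x) - + p *ℤ + x       ≡⟨ cong (λ z → + z - + p *ℤ + x) m+px≡n+py ⟩
  + (n + p * y) - + p *ℤ + x       ≡⟨ cong (_- + p *ℤ + x) (embed n y) ⟨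
  + n +ℤ + p *ℤ + y - + p *ℤ + x   ≡⟨ regroup (+ n) (+ p) (+ x) (+ y) ⟩
  (+ p) *ℤ (+ y - + x) +ℤ + n      ∎
  where
  open ≡-Reasoning
  embed : ∀ m x → + m +ℤ + p *ℤ + x ≡ + (m + p * x)
  embed m x = trans (cong (+ m +ℤ_) (sym (pos-* p x))) (sym (pos-+ m (p * x)))
  cancel : ∀ (i j : ℤ) → i ≡ i +ℤ j - j
  cancel = ℤ-Solver.solve-∀
  regroup : ∀ (n p x y : ℤ) → n +ℤ p *ℤ y - p *ℤ x ≡ p *ℤ (y - x) +ℤ n
  regroup = ℤ-Solver.solve-∀

mainTheorem8 : (a b c k : ℕ) → 1 ≤ a → 1 ≤ b → 1 ≤ c → 1 ≤ k →
    ((T : KGrid k) → IsKTiling a b c k T → IsKTiling c b a k (Φ a b c k T))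
    × ((T T′ : KGrid k) → IsKTiling a b c k T → IsKTiling a b c k T′ →
        SameKT c b a k (Φ a b c k T) (Φ a b c k T′) → SameKT a b c k T T′)
    × ((S : KGrid k) → IsKTiling c b a k S →
        Σ (KGrid k) λ T → IsKTiling a b c k T × SameKT c b a k (Φ a b c k T) S)
    × ((T : KGrid k) → IsKTiling a b c k T → (j : ℕ) → interactions a b c k T ≡ j →
        + interactions c b a k (Φ a b c k T)
          ≡ (+ (k C 2)) *ℤ (+ (b * c) - + (a * b)) +ℤ + j)
mainTheorem8 a b c k 1≤a _ 1≤c _ =
    (λ T → Φ-tiling)
  , (λ T T′ _ _ ΦT≈ΦT′ i x y Δ →
       trans (sym (Φ-involutive T i x y Δ)) (trans (Φ-cong ΦT≈ΦT′ i x y Δ) (Φ-involutive T′ i x y Δ)))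
  , (λ S S-tiles → Φ c b a k S , Φ-tiling S-tiles , Φ-involutive S)
  , (λ T T-tiles j IT≡j → m+p*x≡n+p*y⇒m≡p*[y-x]+n _ j (k C 2) (a * b) (b * c)
       (trans (interactions-Φ-shift 1≤a 1≤c T-tiles) (cong (_+ (k C 2) * (b * c)) IT≡j)))
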